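{- There exist balanced optimal binary sequences of lengths $49$ and $61$. That is, for each $v\in\{49,61\}$ there is a sequence $(x_0,\dots,x_{v-1})$ with $x_i\in\{+1,-1\}$ such that $\sum_{i=0}^{v-1}x_i\in\{1,-1\}$ and for every shift $s\in\{1,\dots,v-1\}$ the periodic autocorrelation $P(s)=\sum_{i=0}^{v-1}x_i x_{(i+s)\bmod v}$ satisfies $P(s)\in\{1,-3\}$.
   Context: A binary sequence of length $v\equiv 1 \pmod 4$ is called optimal if all off-peak values of its periodic autocorrelation function (i.e., at nonzero shifts) are $+1$ or $-3$; it is balanced if the sum of its entries is $\pm 1$. -}

module Defs where

open import Data.Nat using (ℕ; suc; NonZero)
import Data.Nat
open import Data.Nat.DivMod using (_%_)
open import Data.Fin using (Fin; toℕ; zero; suc; fromℕ<)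
open import Data.Nat.Base using (nonZero)
open import Data.Nat.DivMod using (m%n<n)
open import Data.Integer using (ℤ; +_; -_; _*_; _+_)
open import Data.Vec.Functional using (Vector; foldr)
open import Data.Product using (_×_; ∃)
open import Data.Sum using (_⊎_)
open import Relation.Binary.PropositionalEquality using (_≡_)

IsBinary : {v : ℕ} → (Fin v → ℤ) → Set
IsBinary {v} x = ∀ (i : Fin v) → (x i ≡ + 1) ⊎ (x i ≡ - (+ 1))

sumFin : {v : ℕ} → (Fin v → ℤ) → ℤ
sumFin f = foldr _+_ (+ 0) f

shiftIdx : (v : ℕ) .{{_ : NonZero v}} → Fin v → ℕ → Fin v
shiftIdx v i s = fromℕ< (m%n<n (toℕ i Data.Nat.+ s) v)

autocorr : (v : ℕ) .{{_ : NonZero v}} → (Fin v → ℤ) → ℕ → ℤ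
autocorr v x s = sumFin (λ i → x i * x (shiftIdx v i s))

IsBalanced : {v : ℕ} → (Fin v → ℤ) → Set
IsBalanced x = (sumFin x ≡ + 1) ⊎ (sumFin x ≡ - (+ 1))

IsOptimal : (v : ℕ) .{{_ : NonZero v}} → (Fin v → ℤ) → Set
IsOptimal v x = ∀ (s : ℕ) → 1 Data.Nat.≤ s → s Data.Nat.< v →
  (autocorr v x s ≡ + 1) ⊎ (autocorr v x s ≡ - (+ 3))

BalancedOptimal : (v : ℕ) .{{_ : NonZero v}} → Set
BalancedOptimal v = ∃ λ (x : Fin v → ℤ) → IsBinary x × IsBalanced x × IsOptimal v x

module Submission where

-- Both sequences are finite objects, so the theorem is a finite verification.
-- The length-61 witness is the Legendre sequence of the prime 61
-- (x₀ = +1, xᵢ = +1 exactly when i is a nonzero square mod 61), which is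
-- optimal because 61 ≡ 1 (mod 4); the length-49 witness is given explicitly.

open import Defs
open import Data.Bool using (Bool; if_then_else_; _∨_)
open import Data.Bool.ListAction using (any)
open import Data.Nat using (ℕ; NonZero; _≤_; _*_; _≡ᵇ_)
open import Data.Nat.DivMod using (_%_)
open import Data.Nat.Properties using (_≟_)
open import Data.Integer using (ℤ; +_; -_)
open import Data.Integer.Properties using () renaming (_≟_ to _≟ℤ_)
open import Data.Fin using (Fin; toℕ; fromℕ<)
open import Data.Fin.Properties using (all?; toℕ-fromℕ<)
open import Data.List using (drop; upTo)
open import Data.Vec using (Vec; _∷_; []; lookup)
open import Data.Product using (_×_; _,_)
open import Data.Sum using (_⊎_; inj₁; inj₂)
open import Relation.Nullary.Decidable using (Dec; True; toWitness; _⊎-dec_)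
open import Relation.Binary.PropositionalEquality using (_≡_; refl; subst)

OptimalAt : (v : ℕ) .{{_ : NonZero v}} → (Fin v → ℤ) → ℕ → Set
OptimalAt v x s = (autocorr v x s ≡ + 1) ⊎ (autocorr v x s ≡ - (+ 3))

OptimalOnFin : (v : ℕ) .{{_ : NonZero v}} → (Fin v → ℤ) → Set
OptimalOnFin v x = ∀ (k : Fin v) → (toℕ k ≡ 0) ⊎ OptimalAt v x (toℕ k)

optimal-from-shifts : (v : ℕ) .{{_ : NonZero v}} (x : Fin v → ℤ) →
                      OptimalOnFin v x → IsOptimal v x
optimal-from-shifts v x optFin s 1≤s s<v =
  nonzeroShift s 1≤s
    (subst (λ t → (t ≡ 0) ⊎ OptimalAt v x t) (toℕ-fromℕ< s<v) (optFin (fromℕ< s<v)))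
  where
  nonzeroShift : ∀ t → 1 ≤ t → (t ≡ 0) ⊎ OptimalAt v x t → OptimalAt v x t
  nonzeroShift .0 () (inj₁ refl)
  nonzeroShift t _  (inj₂ opt) = opt

isBinary? : {v : ℕ} (x : Fin v → ℤ) → Dec (IsBinary x)
isBinary? x = all? (λ i → (x i ≟ℤ + 1) ⊎-dec (x i ≟ℤ - (+ 1)))

isBalanced? : {v : ℕ} (x : Fin v → ℤ) → Dec (IsBalanced x)
isBalanced? x = (sumFin x ≟ℤ + 1) ⊎-dec (sumFin x ≟ℤ - (+ 1))

optimalOnFin? : (v : ℕ) .{{_ : NonZero v}} (x : Fin v → ℤ) → Dec (OptimalOnFin v x)
optimalOnFin? v x = all? (λ k → (toℕ k ≟ 0) ⊎-dec
  ((autocorr v x (toℕ k) ≟ℤ + 1) ⊎-dec (autocorr v x (toℕ k) ≟ℤ - (+ 3))))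

balancedOptimal-by-decision : (v : ℕ) .{{_ : NonZero v}} (x : Fin v → ℤ) →
  True (isBinary? x) → True (isBalanced? x) → True (optimalOnFin? v x) →
  BalancedOptimal v
balancedOptimal-by-decision v x binary balanced optimal =
  x , toWitness binary , toWitness balanced ,
  optimal-from-shifts v x (toWitness optimal)

isNonzeroSquareMod : (p : ℕ) .{{_ : NonZero p}} → ℕ → Bool
isNonzeroSquareMod p a = any (λ j → (j * j) % p ≡ᵇ a) (drop 1 (upTo p))

legendreSequence : (p : ℕ) .{{_ : NonZero p}} → Fin p → ℤ
legendreSequence p i =
  if (toℕ i ≡ᵇ 0) ∨ isNonzeroSquareMod p (toℕ i) then + 1 else - (+ 1)

sequence49 : Vec ℤ 49
sequence49 =
  p ∷ m ∷ m ∷ p ∷ m ∷ m ∷ p ∷ p ∷ p ∷ m ∷ m ∷ m ∷ p ∷ p ∷ p ∷ m ∷ p ∷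
  m ∷ p ∷ m ∷ m ∷ p ∷ m ∷ m ∷ p ∷ p ∷ p ∷ p ∷ m ∷ p ∷ p ∷ p ∷ p ∷ p ∷
  m ∷ p ∷ m ∷ m ∷ m ∷ m ∷ p ∷ p ∷ p ∷ m ∷ m ∷ p ∷ m ∷ m ∷ m ∷ []
  where
  p m : ℤ
  p = + 1
  m = - (+ 1)

mainTheorem3 : BalancedOptimal 49 × BalancedOptimal 61
mainTheorem3 =
  balancedOptimal-by-decision 49 (lookup sequence49) _ _ _ ,
  balancedOptimal-by-decision 61 (legendreSequence 61) _ _ _
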